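{- The percolation reduction $\to_{\mathsf{pr}}$ on EPCF terms is strongly normalizing; more precisely, for all EPCF terms $M,N$, if $M\to_{\mathsf{pr}}N$ then $|M|_h>|N|_h$.
   Context: EPCF terms: $L,M,N::=x\mid M\cdot N\mid\lambda x.M\mid\mathbf{fix}\,M\mid M\langle N/x\rangle\mid\mathbf 0\mid\mathbf{pred}\,M\mid\mathbf{succ}\,M\mid\mathbf{ifz}(L,M,N)$ ($x$ bound in $M$ in $M\langle N/x\rangle$). For $\sigma=\langle N_1/x_1\rangle\cdots\langle N_n/x_n\rangle$ ($x_i$ distinct), $M^\sigma=(\cdots(M\langle N_1/x_1\rangle)\cdots)\langle N_n/x_n\rangle$, $\mathrm{dom}\sigma=\{x_i\}$, $\sigma(x_i)=N_i$. Evaluation contexts $E::=\square\mid E\cdot M\mid\mathbf{pred}\,E\mid\mathbf{succ}\,E\mid\mathbf{ifz}(E,M,N)$. Percolation reduction $\to_{\mathsf{pr}}$ (σ nonempty): $E[x^\sigma]\to E[N]$ if $\sigma(x)=N$; $E[y^\sigma]\to E[y]$ if $y\notin\mathrm{dom}\sigma$; $E[\mathbf 0^\sigma]\to E[\mathbf 0]$; $E[(M\cdot N)^\sigma]\to E[M^\sigma\cdot N^\sigma]$; $E[(\mathbf{pred}\,M)^\sigma]\to E[\mathbf{pred}(M^\sigma)]$; $E[(\mathbf{succ}\,M)^\sigma]\to E[\mathbf{succ}(M^\sigma)]$; $E[\mathbf{ifz}(L,M,N)^\sigma]\to E[\mathbf{ifz}(L^\sigma,M^\sigma,N^\sigma)]$;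 $E[(\mathbf{fix}\,M)^\sigma]\to E[\mathbf{fix}(M^\sigma)]$. Head size: $|x|_h=|\mathbf 0|_h=1$; $|M\langle N/x\rangle|_h=|M|_h\cdot(|N|_h+1)$; $|M\cdot N|_h=|\lambda x.M|_h=|\mathbf{pred}\,M|_h=|\mathbf{succ}\,M|_h=|\mathbf{fix}\,M|_h=|M|_h+1$; $|\mathbf{ifz}(L,M,N)|_h=|L|_h+1$. -}

module Defs where

open import Data.Nat using (ℕ; suc; _+_; _*_)
open import Data.Product using (_×_; _,_; proj₁)
open import Data.List using (List; []; _∷_; map)
open import Data.List.Membership.Propositional using (_∈_; _∉_)
open import Data.List.Relation.Unary.Unique.Propositional using (Unique)
open import Relation.Binary.PropositionalEquality using (_≢_)

Var : Set
Var = ℕ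

-- EPCF terms.  In  esub M x N  (written M⟨N/x⟩) the variable x is bound in M.
data Term : Set where
  var  : Var → Term
  app  : Term → Term → Term
  lam  : Var → Term → Term
  fix  : Term → Term
  esub : Term → Var → Term → Term
  zero : Term
  pred : Term → Term
  succ : Term → Term
  ifz  : Term → Term → Term → Term

-- An explicit substitution σ = ⟨N₁/x₁⟩⋯⟨Nₙ/xₙ⟩ as the list [(x₁,N₁),…,(xₙ,Nₙ)].
ESubst : Set
ESubst = List (Var × Term)

dom : ESubst → List Var
dom σ = map proj₁ σ

_^_ : Term → ESubst → Term
M ^ []            = M
M ^ ((x , N) ∷ σ) = esub M x N ^ σ

record Good (σ : ESubst) : Set where
  field
    nonempty : σ ≢ []
    distinct : Unique (dom σ)

data ECtx : Set where
  hole  : ECtx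
  appL  : ECtx → Term → ECtx
  predE : ECtx → ECtx
  succE : ECtx → ECtx
  ifzE  : ECtx → Term → Term → ECtx

plug : ECtx → Term → Term
plug hole          T = T
plug (appL E M)    T = app (plug E T) M
plug (predE E)     T = pred (plug E T)
plug (succE E)     T = succ (plug E T)
plug (ifzE E M N)  T = ifz (plug E T) M N

-- Root percolation steps (σ nonempty with distinct variables);
-- σ(x) = N is expressed as (x , N) ∈ σ, which determines N by distinctness.
data _↦pr_ : Term → Term → Set where
  pr-var  : ∀ {σ x N} → Good σ → (x , N) ∈ σ → (var x ^ σ) ↦pr N
  pr-gc   : ∀ {σ y} → Good σ → y ∉ dom σ → (var y ^ σ) ↦pr var y
  pr-zero : ∀ {σ} → Good σ → (zero ^ σ) ↦pr zero
  pr-app  : ∀ {σ M N} → Good σ → (app M N ^ σ) ↦pr app (M ^ σ) (N ^ σ)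
  pr-pred : ∀ {σ M} → Good σ → (pred M ^ σ) ↦pr pred (M ^ σ)
  pr-succ : ∀ {σ M} → Good σ → (succ M ^ σ) ↦pr succ (M ^ σ)
  pr-ifz  : ∀ {σ L M N} → Good σ → (ifz L M N ^ σ) ↦pr ifz (L ^ σ) (M ^ σ) (N ^ σ)
  pr-fix  : ∀ {σ M} → Good σ → (fix M ^ σ) ↦pr fix (M ^ σ)

data _→pr_ : Term → Term → Set where
  ctx : ∀ {E M N} → M ↦pr N → plug E M →pr plug E N

∣_∣h : Term → ℕ
∣ var x ∣h      = 1
∣ zero ∣h       = 1
∣ esub M x N ∣h = ∣ M ∣h * (∣ N ∣h + 1)
∣ app M N ∣h    = suc ∣ M ∣h
∣ lam x M ∣h    = suc ∣ M ∣h
∣ pred M ∣h     = suc ∣ M ∣h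
∣ succ M ∣h     = suc ∣ M ∣h
∣ fix M ∣h      = suc ∣ M ∣h
∣ ifz L M N ∣h  = suc ∣ L ∣h

-- The head size of M^σ is ∣M∣h · w, where w = ∏(∣Nᵢ∣h + 1) is the weight of σ.
-- Percolating σ through a head constructor turns (1 + ∣M'∣h) · w into 1 + ∣M'∣h · w,
-- a strict drop because w ≥ 2 for nonempty σ. A lookup x^σ → σ(x) trades w for ∣σ(x)∣h < w. Evaluation
-- contexts only add 1 per layer on the left spine, so they preserve the decrease.
module Submission where

open import Defs
open import Data.Nat using (ℕ; suc; _+_; _*_; _≤_; _<_; _>_; s≤s; z≤n)
open import Data.Nat.Properties
open import Data.Product using (_,_)
open import Data.List using ([]; _∷_)
open import Data.List.Membership.Propositional using (_∈_)
open import Data.List.Relation.Unary.Any using (here; there)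
open import Relation.Binary.PropositionalEquality
open import Relation.Nullary using (contradiction)

weight : ESubst → ℕ
weight []            = 1
weight ((x , N) ∷ σ) = (∣ N ∣h + 1) * weight σ

∣^∣h : ∀ M σ → ∣ M ^ σ ∣h ≡ ∣ M ∣h * weight σ
∣^∣h M []            = sym (*-identityʳ ∣ M ∣h)
∣^∣h M ((x , N) ∷ σ) = begin
  ∣ esub M x N ^ σ ∣h                    ≡⟨ ∣^∣h (esub M x N) σ ⟩
  ∣ M ∣h * (∣ N ∣h + 1) * weight σ       ≡⟨ *-assoc ∣ M ∣h (∣ N ∣h + 1) (weight σ) ⟩
  ∣ M ∣h * ((∣ N ∣h + 1) * weight σ)     ∎
  where open ≡-Reasoning

∣∣h-positive : ∀ T → 1 ≤ ∣ T ∣h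
∣∣h-positive (var x)      = s≤s z≤n
∣∣h-positive (app M N)    = s≤s z≤n
∣∣h-positive (lam x M)    = s≤s z≤n
∣∣h-positive (fix M)      = s≤s z≤n
∣∣h-positive (esub M x N) = *-mono-≤ (∣∣h-positive M) (m≤n+m 1 ∣ N ∣h)
∣∣h-positive zero         = s≤s z≤n
∣∣h-positive (pred M)     = s≤s z≤n
∣∣h-positive (succ M)     = s≤s z≤n
∣∣h-positive (ifz L M N)  = s≤s z≤n

weight-positive : ∀ σ → 1 ≤ weight σ
weight-positive []            = s≤s z≤n
weight-positive ((x , N) ∷ σ) = *-mono-≤ (m≤n+m 1 ∣ N ∣h) (weight-positive σ)

weight-nonempty : ∀ {σ} → σ ≢ [] → 2 ≤ weight σ
weight-nonempty {[]}          σ≢[] = contradiction refl σ≢[]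
weight-nonempty {(x , N) ∷ σ} _    =
  *-mono-≤ (+-monoˡ-≤ 1 (∣∣h-positive N)) (weight-positive σ)

∈⇒<weight : ∀ {σ x N} → (x , N) ∈ σ → ∣ N ∣h < weight σ
∈⇒<weight {(_ , N) ∷ σ} (here refl) = begin-strict
  ∣ N ∣h                  <⟨ m<m+n ∣ N ∣h (s≤s z≤n) ⟩
  ∣ N ∣h + 1              ≡⟨ *-identityʳ (∣ N ∣h + 1) ⟨
  (∣ N ∣h + 1) * 1        ≤⟨ *-monoʳ-≤ (∣ N ∣h + 1) (weight-positive σ) ⟩
  (∣ N ∣h + 1) * weight σ ∎
  where open ≤-Reasoning
∈⇒<weight {(_ , M) ∷ σ} (there N∈σ) = begin-strict
  _                       <⟨ ∈⇒<weight N∈σ ⟩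
  weight σ                ≡⟨ *-identityˡ (weight σ) ⟨
  1 * weight σ            ≤⟨ *-monoˡ-≤ (weight σ) (m≤n+m 1 ∣ M ∣h) ⟩
  (∣ M ∣h + 1) * weight σ ∎
  where open ≤-Reasoning

percolate-decrease : ∀ {σ} M M' → Good σ → ∣ M ∣h ≡ suc ∣ M' ∣h →
                     suc ∣ M' ^ σ ∣h < ∣ M ^ σ ∣h
percolate-decrease {σ} M M' g size rewrite ∣^∣h M σ | ∣^∣h M' σ | size =
  +-monoˡ-≤ (∣ M' ∣h * weight σ) (weight-nonempty (Good.nonempty g))

leaf-decrease : ∀ {σ} T → Good σ → ∣ T ∣h ≡ 1 → 1 < ∣ T ^ σ ∣h
leaf-decrease {σ} T g size rewrite ∣^∣h T σ | size | +-identityʳ (weight σ) =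
  weight-nonempty (Good.nonempty g)

↦pr-decrease : ∀ {M N} → M ↦pr N → ∣ N ∣h < ∣ M ∣h
↦pr-decrease (pr-var {σ} {x} _ N∈σ) rewrite ∣^∣h (var x) σ | +-identityʳ (weight σ) =
  ∈⇒<weight N∈σ
↦pr-decrease (pr-gc {y = y} g _) = leaf-decrease (var y) g refl
↦pr-decrease (pr-zero g)         = leaf-decrease zero g refl
↦pr-decrease (pr-app {M = M} {N} g)    = percolate-decrease (app M N) M g refl
↦pr-decrease (pr-pred {M = M} g)       = percolate-decrease (pred M) M g refl
↦pr-decrease (pr-succ {M = M} g)       = percolate-decrease (succ M) M g refl
↦pr-decrease (pr-ifz {L = L} {M} {N} g) = percolate-decrease (ifz L M N) L g refl
↦pr-decrease (pr-fix {M = M} g)        = percolate-decrease (fix M) M g refl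

plug-mono-< : ∀ E {M N} → ∣ M ∣h < ∣ N ∣h → ∣ plug E M ∣h < ∣ plug E N ∣h
plug-mono-< hole          M<N = M<N
plug-mono-< (appL E _)    M<N = s≤s (plug-mono-< E M<N)
plug-mono-< (predE E)     M<N = s≤s (plug-mono-< E M<N)
plug-mono-< (succE E)     M<N = s≤s (plug-mono-< E M<N)
plug-mono-< (ifzE E _ _)  M<N = s≤s (plug-mono-< E M<N)

lemma2p21 : ∀ (M N : Term) → M →pr N → ∣ M ∣h > ∣ N ∣h
lemma2p21 _ _ (ctx {E} step) = plug-mono-< E (↦pr-decrease step)
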